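{- For positive integers $n$ and $m$, $$\chi_{\rho}(P_n\circ K_m) \leq nm-\left \lceil \frac{n}{2} \right \rceil-\sum_{i=2}^{m}\left \lceil \frac{n}{i+1} \right \rceil- \left \lfloor \frac{\left \lfloor \frac{n}{2} \right \rfloor -1}{\left \lfloor \frac{m+1}{2} \right \rfloor +1} \right \rfloor + m.$$
   Context: $P_n$ is the path on $n$ vertices and $K_m$ the complete graph on $m$ vertices. A $k$-packing coloring of a graph is a map $c:V\to\{1,\dots,k\}$ such that two distinct vertices with $c(u)=c(v)=i$ are at distance more than $i$; the packing chromatic number $\chi_\rho$ is the least such $k$. The lexicographic product $G\circ H$ has vertex set $V(G)\times V(H)$, with $(g_1,h_1)\sim(g_2,h_2)$ iff $g_1g_2\in E(G)$, or $g_1=g_2$ and $h_1h_2\in E(H)$. -}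

module Defs where

open import Data.Nat using (ℕ; zero; suc; _+_; _*_; _≤_; _<_; _/_; NonZero)
open import Data.Fin using (Fin; toℕ)
open import Data.Product using (_×_; _,_; Σ)
open import Data.Sum using (_⊎_)
open import Data.Integer as ℤ using (ℤ; +_)
open import Relation.Binary.PropositionalEquality using (_≡_)
open import Relation.Nullary using (¬_)

record Graph : Set₁ where
  field
    V   : Set
    Adj : V → V → Set
open Graph public

data Walk (G : Graph) : V G → V G → ℕ → Set where
  here : ∀ {u} → Walk G u u 0
  step : ∀ {u w v d} → Adj G u w → Walk G w v d → Walk G u v (suc d)

-- distance d(u,v) ≤ i  iff  there is a walk of length at most i
DistLe : (G : Graph) → V G → V G → ℕ → Set
DistLe G u v i = Σ ℕ (λ d → d ≤ i × Walk G u v d)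

-- c : V → Fin k encodes colours 1..k (colour of u is toℕ (c u) + 1).
-- k-packing colouring: equal colour i on distinct u, v forces d(u,v) > i.
IsPackingColoring : (G : Graph) (k : ℕ) → (V G → Fin k) → Set
IsPackingColoring G k c =
  ∀ u v → ¬ (u ≡ v) → toℕ (c u) ≡ toℕ (c v) → ¬ DistLe G u v (suc (toℕ (c u)))

PackingChromaticLe : Graph → ℤ → Set
PackingChromaticLe G b =
  Σ ℕ (λ k → (+ k) ℤ.≤ b × Σ (V G → Fin k) (IsPackingColoring G k))

PathAdj : (n : ℕ) → Fin n → Fin n → Set
PathAdj n i j = (suc (toℕ i) ≡ toℕ j) ⊎ (suc (toℕ j) ≡ toℕ i)

CompleteAdj : (m : ℕ) → Fin m → Fin m → Set
CompleteAdj m i j = ¬ (i ≡ j)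

lex : Graph → Graph → Graph
lex G H = record
  { V = V G × V H
  ; Adj = λ { (g₁ , h₁) (g₂ , h₂) → Adj G g₁ g₂ ⊎ ((g₁ ≡ g₂) × Adj H h₁ h₂) } }

P : ℕ → Graph
P n = record { V = Fin n ; Adj = PathAdj n }

K : ℕ → Graph
K m = record { V = Fin m ; Adj = CompleteAdj m }

ceilDiv : ℕ → (d : ℕ) → .{{NonZero d}} → ℕ
ceilDiv a d = (a + (d Data.Nat.∸ 1)) / d

sumTerm : ℕ → ℕ → ℕ
sumTerm n zero = 0
sumTerm n (suc zero) = 0
sumTerm n (suc (suc k)) = sumTerm n (suc k) + ceilDiv n (suc (suc (suc k)))

bound : ℕ → ℕ → ℤ
bound n m =
  ((((+ (n * m)) ℤ.- (+ ceilDiv n 2)) ℤ.- (+ sumTerm n m))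
     ℤ.- (((+ (n / 2)) ℤ.- (+ 1)) ℤ./ℕ suc ((m + 1) / 2)))
  -- ℤ./ℕ is floor division (non-negative remainder), so n = 1 gives ⌊-1/d⌋ = -1
  ℤ.+ (+ m)

-- Let layer s of P_n ∘ K_m be the copy of P_n over clique vertex s; the distance
-- between (j, s) and (j', s') is at least |j − j'|.  In layer s, give packing colour
-- s + 1 to the positions divisible by s + 2, and in layer 0 give colour m + 1 to the
-- positions ≡ 1 (mod 2(⌊(m+1)/2⌋ + 1)); that period is even and at least m + 2, so
-- these positions are odd and far enough apart.  Every other vertex gets a fresh
-- colour of its own.  Counting the reused vertices, ⌈n/(s+2)⌉ in layer s plus
-- ⌊(⌊n/2⌋−1)/(⌊(m+1)/2⌋+1)⌋ + 1 more in layer 0, gives exactly the bound.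

module Submission where

open import Data.Bool using (Bool; true; false; not; _∨_; if_then_else_)
open import Data.Fin using (Fin; toℕ; fromℕ<)
open import Data.Fin.Properties using (toℕ<n; toℕ-fromℕ<; toℕ-injective)
open import Data.Maybe using (Maybe; just; nothing; is-just; is-nothing; fromMaybe)
open import Data.Nat
open import Data.Nat.DivMod
open import Data.Nat.Divisibility using (divides-refl; m∣m*n; ∣-refl)
open import Data.Nat.Properties
open import Data.Nat.Tactic.RingSolver using (solve-∀)
open import Data.Product using (_×_; _,_; proj₁)
open import Data.Sum using (_⊎_; inj₁; inj₂; map; map₁)
open import Function using (_∘_)
open import Relation.Binary.Definitions using (tri<; tri≈; tri>)
open import Relation.Binary.PropositionalEquality
open import Relation.Nullary using (contradiction)
import Data.Integer as ℤ
import Data.Integer.Properties as ℤP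
import Data.Integer.Tactic.RingSolver as ℤSolver

open import Defs

count : (ℕ → Bool) → ℕ → ℕ
count p zero    = 0
count p (suc n) = if p n then suc (count p n) else count p n

count-cong : ∀ {p q} → p ≗ q → ∀ n → count p n ≡ count q n
count-cong p≗q zero = refl
count-cong {p} {q} p≗q (suc n) rewrite p≗q n | count-cong p≗q n = refl

count-+ : ∀ p a x → count p (a + x) ≡ count p a + count (p ∘ (a +_)) x
count-+ p a zero rewrite +-identityʳ a = sym (+-identityʳ _)
count-+ p a (suc x) rewrite +-suc a x with p (a + x)
... | true  = trans (cong suc (count-+ p a x)) (sym (+-suc _ _))
... | false = count-+ p a x

count-mono : ∀ p {a b} → a ≤ b → count p a ≤ count p b
count-mono p {a} a≤b with m≤n⇒∃[o]m+o≡n a≤b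
... | o , refl rewrite count-+ p a o = m≤m+n _ _

count-< : ∀ p {j b} → p j ≡ true → j < b → count p j < count p b
count-< p {j} pj j<b = ≤-trans (≤-reflexive count-suc) (count-mono p j<b)
  where
  count-suc : suc (count p j) ≡ count p (suc j)
  count-suc rewrite pj = refl

count-complement : ∀ p n → count (not ∘ p) n + count p n ≡ n
count-complement p zero = refl
count-complement p (suc n) with p n
... | true  = trans (+-suc _ _) (cong suc (count-complement p n))
... | false = cong suc (count-complement p n)

count-∨ : ∀ p q → (∀ j → q j ≡ true → p j ≡ false) → ∀ n →
          count (λ j → p j ∨ q j) n ≡ count p n + count q n
count-∨ p q disjoint zero = refl
count-∨ p q disjoint (suc n) with p n in pn | q n in qn | count-∨ p q disjoint n
... | true  | true  | _  = contradiction (trans (sym pn) (disjoint n qn)) λ ()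
... | true  | false | ih = cong suc ih
... | false | true  | ih = trans (cong suc ih) (sym (+-suc _ _))
... | false | false | ih = ih

multiple : (d : ℕ) .{{_ : NonZero d}} → ℕ → Bool
multiple d j = j % d ≡ᵇ 0

multiple⇒%≡0 : ∀ d .{{_ : NonZero d}} {j} → multiple d j ≡ true → j % d ≡ 0
multiple⇒%≡0 d {j} isMultiple with j % d | isMultiple
... | zero | _ = refl

1+multiple : (d : ℕ) .{{_ : NonZero d}} → ℕ → Bool
1+multiple d zero    = false
1+multiple d (suc a) = multiple d a

count-1+multiple : ∀ d .{{_ : NonZero d}} n → count (1+multiple d) (suc n) ≡ count (multiple d) n
count-1+multiple d n = count-+ (1+multiple d) 1 n

module _ (d : ℕ) where
  private
    D = suc d

  multiple-periodic : ∀ j → multiple D (D + j) ≡ multiple D j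
  multiple-periodic j = cong (_≡ᵇ 0) (trans (%-congˡ (+-comm D j)) ([m+n]%n≡m%n j D))

  count-multiple-≤ : ∀ r → r ≤ d → count (multiple D) (suc r) ≡ 1
  count-multiple-≤ zero    _   = refl
  count-multiple-≤ (suc r) r<d rewrite m<n⇒m%n≡m {{_}} (s≤s r<d) =
    count-multiple-≤ r (<⇒≤ r<d)

  ceilDiv-≤ : ∀ r → r ≤ d → ceilDiv (suc r) D ≡ 1
  ceilDiv-≤ r r≤d = begin
    (suc r + d) / D         ≡⟨ m/n≡1+[m∸n]/n (s≤s (m≤n+m d r)) ⟩
    suc ((r + d ∸ d) / D)   ≡⟨ cong (λ x → suc (x / D)) (m+n∸n≡m r d) ⟩
    suc (r / D)             ≡⟨ cong suc (m<n⇒m/n≡0 (s≤s r≤d)) ⟩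
    1                       ∎
    where open ≡-Reasoning

  count-multiple-< : ∀ r → r < D → count (multiple D) r ≡ ceilDiv r D
  count-multiple-< zero    _         = sym (m<n⇒m/n≡0 (n<1+n d))
  count-multiple-< (suc r) (s≤s r<d) =
    trans (count-multiple-≤ r (<⇒≤ r<d)) (sym (ceilDiv-≤ r (<⇒≤ r<d)))

  count-multiple-block : ∀ k r → count (multiple D) (k * D + r) ≡ k + count (multiple D) r
  count-multiple-block zero    r = refl
  count-multiple-block (suc k) r = begin
    count (multiple D) (D + k * D + r)
      ≡⟨ cong (count (multiple D)) (+-assoc D (k * D) r) ⟩
    count (multiple D) (D + (k * D + r))
      ≡⟨ count-+ (multiple D) D (k * D + r) ⟩
    count (multiple D) D + count (multiple D ∘ (D +_)) (k * D + r)
      ≡⟨ cong₂ _+_ (count-multiple-≤ d ≤-refl) (count-cong multiple-periodic (k * D + r)) ⟩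
    suc (count (multiple D) (k * D + r))
      ≡⟨ cong suc (count-multiple-block k r) ⟩
    suc (k + count (multiple D) r) ∎
    where open ≡-Reasoning

  ceilDiv-block : ∀ k r → ceilDiv (k * D + r) D ≡ k + ceilDiv r D
  ceilDiv-block k r = begin
    (k * D + r + d) / D       ≡⟨ cong (_/ D) (trans (+-assoc (k * D) r d) (+-comm (k * D) (r + d))) ⟩
    (r + d + k * D) / D       ≡⟨ +-distrib-/-∣ʳ (r + d) (divides-refl k) ⟩
    (r + d) / D + k * D / D   ≡⟨ cong ((r + d) / D +_) (m*n/n≡m k D) ⟩
    (r + d) / D + k           ≡⟨ +-comm _ k ⟩
    k + (r + d) / D           ∎
    where open ≡-Reasoning

  count-multiple : ∀ n → count (multiple D) n ≡ ceilDiv n D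
  count-multiple n = begin
    count (multiple D) n                   ≡⟨ cong (count (multiple D)) n≡ ⟩
    count (multiple D) (n / D * D + n % D) ≡⟨ count-multiple-block (n / D) (n % D) ⟩
    n / D + count (multiple D) (n % D)     ≡⟨ cong (n / D +_) (count-multiple-< (n % D) (m%n<n n D)) ⟩
    n / D + ceilDiv (n % D) D              ≡⟨ ceilDiv-block (n / D) (n % D) ⟨
    ceilDiv (n / D * D + n % D) D          ≡⟨ cong (λ x → ceilDiv x D) n≡ ⟨
    ceilDiv n D                            ∎
    where
    open ≡-Reasoning
    n≡ : n ≡ n / D * D + n % D
    n≡ = trans (m≡m%n+[m/n]*n n D) (+-comm (n % D) _)

%-≡⇒+≤ : ∀ e .{{_ : NonZero e}} {j j'} → j % e ≡ j' % e → j < j' → j + e ≤ j'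
%-≡⇒+≤ e {j} {j'} same j<j' = begin
  j + e                ≡⟨ cong (_+ e) (m≡m%n+[m/n]*n j e) ⟩
  j % e + j / e * e + e   ≡⟨ +-assoc (j % e) _ e ⟩
  j % e + (j / e * e + e) ≡⟨ cong (j % e +_) (+-comm _ e) ⟩
  j % e + suc (j / e) * e ≤⟨ +-monoʳ-≤ (j % e) (*-monoˡ-≤ e quot<) ⟩
  j % e + j' / e * e   ≡⟨ cong (_+ j' / e * e) same ⟩
  j' % e + j' / e * e  ≡⟨ m≡m%n+[m/n]*n j' e ⟨
  j'                   ∎
  where
  open ≤-Reasoning
  quot< : j / e < j' / e
  quot< = *-cancelʳ-< e _ _ (+-cancelˡ-< (j % e) _ _ (subst₂ _<_ (m≡m%n+[m/n]*n j e)
            (trans (m≡m%n+[m/n]*n j' e) (cong (_+ j' / e * e) (sym same))) j<j'))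

%-≡⇒≡⊎≤∣-∣ : ∀ e .{{_ : NonZero e}} {j j'} →
             j % e ≡ j' % e → j ≡ j' ⊎ e ≤ ∣ j - j' ∣
%-≡⇒≡⊎≤∣-∣ e {j} {j'} same with <-cmp j j'
... | tri< j<j' _ _ = inj₂ (subst (e ≤_) (sym (m≤n⇒∣m-n∣≡n∸m (<⇒≤ j<j')))
                        (m+n≤o⇒m≤o∸n e (subst (_≤ j') (+-comm j e) (%-≡⇒+≤ e same j<j'))))
... | tri≈ _ j≡j' _ = inj₁ j≡j'
... | tri> _ _ j>j' = inj₂ (subst (e ≤_) (sym (m≤n⇒∣n-m∣≡n∸m (<⇒≤ j>j')))
                        (m+n≤o⇒m≤o∸n e (subst (_≤ j) (+-comm j' e) (%-≡⇒+≤ e (sym same) j>j'))))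

multiples-separated : ∀ d .{{_ : NonZero d}} {j j'} →
                      multiple d j ≡ true → multiple d j' ≡ true → j ≡ j' ⊎ d ≤ ∣ j - j' ∣
multiples-separated d {j} {j'} mj mj' =
  %-≡⇒≡⊎≤∣-∣ d (trans (multiple⇒%≡0 d {j} mj) (sym (multiple⇒%≡0 d {j'} mj')))

1+multiples-separated : ∀ d .{{_ : NonZero d}} {j j'} →
                        1+multiple d j ≡ true → 1+multiple d j' ≡ true → j ≡ j' ⊎ d ≤ ∣ j - j' ∣
1+multiples-separated d {suc a} {suc b} ma mb = map₁ (cong suc) (multiples-separated d ma mb)

∣n-1+n∣≡1 : ∀ n → ∣ n - suc n ∣ ≡ 1
∣n-1+n∣≡1 zero    = refl
∣n-1+n∣≡1 (suc n) = ∣n-1+n∣≡1 n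

module _ {n : ℕ} (H : Graph) where
  private
    G = lex (P n) H
    pos : V G → ℕ
    pos = toℕ ∘ proj₁

  lex-path-adj-∣-∣≤1 : ∀ {u w} → Adj G u w → ∣ pos u - pos w ∣ ≤ 1
  lex-path-adj-∣-∣≤1 {u} (inj₁ (inj₁ u→w)) =
    ≤-reflexive (trans (cong (∣ pos u -_∣) (sym u→w)) (∣n-1+n∣≡1 (pos u)))
  lex-path-adj-∣-∣≤1 {w = w} (inj₁ (inj₂ w→u)) =
    ≤-reflexive (trans (cong (∣_- pos w ∣) (sym w→u))
                       (trans (∣-∣-comm _ (pos w)) (∣n-1+n∣≡1 (pos w))))
  lex-path-adj-∣-∣≤1 {u} (inj₂ (refl , _)) = subst (_≤ 1) (sym (∣n-n∣≡0 (pos u))) z≤n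

  walk-∣-∣≤ : ∀ {u v d} → Walk G u v d → ∣ pos u - pos v ∣ ≤ d
  walk-∣-∣≤ {u} here = ≤-reflexive (∣n-n∣≡0 (pos u))
  walk-∣-∣≤ {u} {v} (step {w = w} u~w walk) = begin
    ∣ pos u - pos v ∣                    ≤⟨ ∣-∣-triangle (pos u) (pos w) (pos v) ⟩
    ∣ pos u - pos w ∣ + ∣ pos w - pos v ∣ ≤⟨ +-mono-≤ (lex-path-adj-∣-∣≤1 u~w) (walk-∣-∣≤ walk) ⟩
    suc _                                ∎
    where open ≤-Reasoning

  separated⇒packing : ∀ {k} (c : V G → Fin k) →
    (∀ u v → toℕ (c u) ≡ toℕ (c v) → u ≡ v ⊎ 2 + toℕ (c u) ≤ ∣ pos u - pos v ∣) →
    IsPackingColoring G k c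
  separated⇒packing c separated u v u≢v same (d , d≤ , walk) with separated u v same
  ... | inj₁ u≡v = u≢v u≡v
  ... | inj₂ far = <⇒≱ far (≤-trans (walk-∣-∣≤ walk) d≤)

module Rank (fresh : ℕ → ℕ → Bool) (n : ℕ) where

  before : ℕ → ℕ
  before zero    = 0
  before (suc s) = before s + count (fresh s) n

  rank : ℕ → ℕ → ℕ
  rank s j = before s + count (fresh s) j

  before-mono : ∀ {s t} → s ≤ t → before s ≤ before t
  before-mono {s} {t} s≤t with m≤n⇒∃[o]m+o≡n s≤t
  ... | o , refl = go o
    where
    go : ∀ o → before s ≤ before (s + o)
    go zero    = ≤-reflexive (cong before (sym (+-identityʳ s)))
    go (suc o) = ≤-trans (go o) (subst (before (s + o) ≤_) (cong before (sym (+-suc s o))) (m≤m+n _ _))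

  rank<before : ∀ {s j t} → fresh s j ≡ true → j < n → s < t → rank s j < before t
  rank<before {s} fsj j<n s<t =
    ≤-trans (+-monoʳ-< (before s) (count-< (fresh s) fsj j<n)) (before-mono s<t)

  rank-injective : ∀ {s j s' j'} → fresh s j ≡ true → fresh s' j' ≡ true → j < n → j' < n →
                   rank s j ≡ rank s' j' → s ≡ s' × j ≡ j'
  rank-injective {s} {j} {s'} {j'} fsj fs'j' j<n j'<n same with <-cmp s s'
  ... | tri< s<s' _ _ = contradiction same (<⇒≢ (<-≤-trans (rank<before fsj j<n s<s') (m≤m+n _ _)))
  ... | tri> _ _ s>s' = contradiction (sym same) (<⇒≢ (<-≤-trans (rank<before fs'j' j'<n s>s') (m≤m+n _ _)))
  ... | tri≈ _ refl _ with <-cmp j j'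
  ...   | tri< j<j' _ _ = contradiction same (<⇒≢ (+-monoʳ-< (before s) (count-< (fresh s) fsj j<j')))
  ...   | tri≈ _ j≡j' _ = refl , j≡j'
  ...   | tri> _ _ j>j' = contradiction (sym same) (<⇒≢ (+-monoʳ-< (before s) (count-< (fresh s) fs'j' j>j')))

m≤2*[[m+1]/2] : ∀ m → m ≤ 2 * ((m + 1) / 2)
m≤2*[[m+1]/2] m = ≤-pred (begin
  suc m                         ≡⟨ +-comm 1 m ⟩
  m + 1                         ≡⟨ m≡m%n+[m/n]*n (m + 1) 2 ⟩
  (m + 1) % 2 + (m + 1) / 2 * 2 ≤⟨ +-monoˡ-≤ _ (≤-pred (m%n<n (m + 1) 2)) ⟩
  1 + (m + 1) / 2 * 2           ≡⟨ cong suc (*-comm ((m + 1) / 2) 2) ⟩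
  suc (2 * ((m + 1) / 2))       ∎)
  where open ≤-Reasoning

module Construction (m n : ℕ) where

  -- A vertex (j, s) is position j of layer s.  Colours are 0-based, so colour c may
  -- only recur at distance at least c + 2.

  period : ℕ
  period = 2 * suc ((m + 1) / 2)

  2+m≤period : 2 + m ≤ period
  2+m≤period = subst (2 + m ≤_) (sym (*-suc 2 ((m + 1) / 2))) (s≤s (s≤s (m≤2*[[m+1]/2] m)))

  special : ℕ → ℕ → Maybe ℕ
  special zero    j = if multiple 2 j then just 0 else if 1+multiple period j then just m else nothing
  special (suc t) j = if multiple (3 + t) j then just (suc t) else nothing

  data SpecialView (s j c : ℕ) : Set where
    multipleOfRow : c ≡ s → multiple (2 + s) j ≡ true → SpecialView s j c
    oneMore       : s ≡ 0 → c ≡ m → 1+multiple period j ≡ true → SpecialView s j c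

  special-view : ∀ s j {c} → special s j ≡ just c → SpecialView s j c
  special-view zero j eq with multiple 2 j in isMultiple | 1+multiple period j in isOneMore | eq
  ... | true  | _    | refl = multipleOfRow refl isMultiple
  ... | false | true | refl = oneMore refl refl isOneMore
  special-view (suc t) j eq with multiple (3 + t) j in isMultiple | eq
  ... | true | refl = multipleOfRow refl isMultiple

  special-separated : ∀ {s s' j j' c} → s < m → s' < m →
                      special s j ≡ just c → special s' j' ≡ just c →
                      (s ≡ s' × j ≡ j') ⊎ 2 + c ≤ ∣ j - j' ∣
  special-separated {s} {s'} {j} {j'} s<m s'<m sj sj'
    with special-view s j sj | special-view s' j' sj'
  ... | multipleOfRow refl mj | multipleOfRow refl mj' = map₁ (refl ,_) (multiples-separated (2 + s) mj mj')
  ... | multipleOfRow refl _ | oneMore _ refl _ = contradiction refl (<⇒≢ s<m)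
  ... | oneMore _ refl _ | multipleOfRow refl _ = contradiction refl (<⇒≢ s'<m)
  ... | oneMore refl refl oj | oneMore refl refl oj' =
    map (refl ,_) (≤-trans 2+m≤period) (1+multiples-separated period oj oj')

  special<new : ∀ {s j c} r → s < m → special s j ≡ just c → c < suc (m + r)
  special<new {s} {j} r s<m sj with special-view s j sj
  ... | multipleOfRow refl _ = s≤s (≤-trans (<⇒≤ s<m) (m≤m+n m r))
  ... | oneMore _ refl _     = s≤s (m≤m+n m r)

  fresh : ℕ → ℕ → Bool
  fresh s j = is-nothing (special s j)

  open Rank fresh n public

  colour : ℕ → ℕ → ℕ
  colour s j = fromMaybe (suc (m + rank s j)) (special s j)

  colours : ℕ
  colours = suc (m + before m)

  colour-< : ∀ {s j} → s < m → j < n → colour s j < colours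
  colour-< {s} {j} s<m j<n with special s j in sj
  ... | just c  = special<new (before m) s<m sj
  ... | nothing = s≤s (+-monoʳ-< m (rank<before (cong is-nothing sj) j<n s<m))

  colour-separated : ∀ {s s' j j'} → s < m → s' < m → j < n → j' < n → colour s j ≡ colour s' j' →
                     (s ≡ s' × j ≡ j') ⊎ 2 + colour s j ≤ ∣ j - j' ∣
  colour-separated {s} {s'} {j} {j'} s<m s'<m j<n j'<n same
    with special s j in sj | special s' j' in sj'
  ... | just _  | just _  = special-separated s<m s'<m sj (trans sj' (cong just (sym same)))
  ... | just _  | nothing = contradiction same (<⇒≢ (special<new (rank s' j') s<m sj))
  ... | nothing | just _  = contradiction (sym same) (<⇒≢ (special<new (rank s j) s'<m sj'))
  ... | nothing | nothing = inj₁ (rank-injective (cong is-nothing sj) (cong is-nothing sj') j<n j'<n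
                                    (+-cancelˡ-≡ m _ _ (suc-injective same)))

  1+multiple⇒odd : ∀ j → 1+multiple period j ≡ true → multiple 2 j ≡ false
  1+multiple⇒odd (suc a) ma = cong (_≡ᵇ 0) (begin
    (1 + a) % 2           ≡⟨ %-distribˡ-+ 1 a 2 ⟩
    (1 + a % 2) % 2       ≡⟨ cong (λ r → (1 + r) % 2) a-even ⟩
    1                     ∎)
    where
    open ≡-Reasoning
    a-even : a % 2 ≡ 0
    a-even = trans (sym (m∣n⇒o%n%m≡o%m 2 period a (m∣m*n (suc ((m + 1) / 2)))))
                   (cong (_% 2) (multiple⇒%≡0 period {a} ma))

  count-fresh-zero : count (fresh 0) n + ceilDiv n 2 + count (1+multiple period) n ≡ n
  count-fresh-zero = begin
    count (fresh 0) n + ceilDiv n 2 + count (1+multiple period) n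
      ≡⟨ +-assoc (count (fresh 0) n) _ _ ⟩
    count (fresh 0) n + (ceilDiv n 2 + count (1+multiple period) n)
      ≡⟨ cong (λ x → count (fresh 0) n + (x + count (1+multiple period) n)) (count-multiple 1 n) ⟨
    count (fresh 0) n + (count (multiple 2) n + count (1+multiple period) n)
      ≡⟨ cong (count (fresh 0) n +_) (count-∨ (multiple 2) (1+multiple period) 1+multiple⇒odd n) ⟨
    count (fresh 0) n + count (λ j → multiple 2 j ∨ 1+multiple period j) n
      ≡⟨ cong (count (fresh 0) n +_) (count-cong special-zero-is-just n) ⟩
    count (fresh 0) n + count (is-just ∘ special 0) n
      ≡⟨ count-complement (is-just ∘ special 0) n ⟩
    n ∎
    where
    open ≡-Reasoning
    special-zero-is-just : ∀ j → multiple 2 j ∨ 1+multiple period j ≡ is-just (special 0 j)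
    special-zero-is-just j with multiple 2 j | 1+multiple period j
    ... | true  | _     = refl
    ... | false | true  = refl
    ... | false | false = refl

  count-fresh-suc : ∀ t → count (fresh (suc t)) n + ceilDiv n (3 + t) ≡ n
  count-fresh-suc t = begin
    count (fresh (suc t)) n + ceilDiv n (3 + t)
      ≡⟨ cong (count (fresh (suc t)) n +_) (count-multiple (2 + t) n) ⟨
    count (fresh (suc t)) n + count (multiple (3 + t)) n
      ≡⟨ cong (count (fresh (suc t)) n +_) (count-cong special-suc-is-just n) ⟩
    count (fresh (suc t)) n + count (is-just ∘ special (suc t)) n
      ≡⟨ count-complement (is-just ∘ special (suc t)) n ⟩
    n ∎
    where
    open ≡-Reasoning
    special-suc-is-just : ∀ j → multiple (3 + t) j ≡ is-just (special (suc t) j)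
    special-suc-is-just j with multiple (3 + t) j
    ... | true  = refl
    ... | false = refl

  count-fresh-all : ∀ k →
    before (suc k) + ceilDiv n 2 + count (1+multiple period) n + sumTerm n (suc k) ≡ n * suc k
  count-fresh-all zero = begin
    0 + count (fresh 0) n + ceilDiv n 2 + count (1+multiple period) n + 0 ≡⟨ +-identityʳ _ ⟩
    count (fresh 0) n + ceilDiv n 2 + count (1+multiple period) n         ≡⟨ count-fresh-zero ⟩
    n                                                                     ≡⟨ *-identityʳ n ⟨
    n * 1                                                                 ∎
    where open ≡-Reasoning
  count-fresh-all (suc k) = begin
    before (suc k) + count (fresh (suc k)) n + A + U + (sumTerm n (suc k) + ceilDiv n (3 + k))
      ≡⟨ regroup (before (suc k)) (count (fresh (suc k)) n) A U (sumTerm n (suc k)) (ceilDiv n (3 + k)) ⟩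
    (count (fresh (suc k)) n + ceilDiv n (3 + k)) + (before (suc k) + A + U + sumTerm n (suc k))
      ≡⟨ cong₂ _+_ (count-fresh-suc k) (count-fresh-all k) ⟩
    n + n * suc k
      ≡⟨ *-suc n (suc k) ⟨
    n * suc (suc k) ∎
    where
    open ≡-Reasoning
    A = ceilDiv n 2
    U = count (1+multiple period) n
    regroup : ∀ b f a u s c → b + f + a + u + (s + c) ≡ (f + c) + (b + a + u + s)
    regroup = solve-∀

  colouring : Fin n × Fin m → Fin colours
  colouring (g , h) = fromℕ< (colour-< (toℕ<n h) (toℕ<n g))

  colouring-packing : IsPackingColoring (lex (P n) (K m)) colours colouring
  colouring-packing = separated⇒packing (K m) colouring separated
    where
    separated : ∀ u v → toℕ (colouring u) ≡ toℕ (colouring v) →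
                u ≡ v ⊎ 2 + toℕ (colouring u) ≤ ∣ toℕ (proj₁ u) - toℕ (proj₁ v) ∣
    separated (g , h) (g' , h') same =
      map (λ (h≡h' , g≡g') → cong₂ _,_ (toℕ-injective g≡g') (toℕ-injective h≡h'))
          (subst (λ c → 2 + c ≤ ∣ toℕ g - toℕ g' ∣) (sym (toℕ-fromℕ< _)))
          (colour-separated (toℕ<n h) (toℕ<n h') (toℕ<n g) (toℕ<n g')
            (trans (sym (toℕ-fromℕ< _)) (trans same (toℕ-fromℕ< _))))

-- Opened only now: ℤ's +_ would make ℕ sections such as (a +_) ambiguous.
open ℤ using (+_)

⌊[⌊[n+1]/2⌋-1]/[q+1]⌋+1≡⌈n/[2q+2]⌉ : ∀ q n →
  ((+ (suc n / 2)) ℤ.- + 1) ℤ./ℕ suc q ℤ.+ + 1 ≡ + ceilDiv n (2 * suc q)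
⌊[⌊[n+1]/2⌋-1]/[q+1]⌋+1≡⌈n/[2q+2]⌉ zero    zero = refl
⌊[⌊[n+1]/2⌋-1]/[q+1]⌋+1≡⌈n/[2q+2]⌉ (suc q) zero =
  cong +_ (sym (m<n⇒m/n≡0 (n<1+n (2 * suc (suc q) ∸ 1))))
⌊[⌊[n+1]/2⌋-1]/[q+1]⌋+1≡⌈n/[2q+2]⌉ q (suc n)
  rewrite m/n≡1+[m∸n]/n {suc (suc n)} {2} (s≤s (s≤s z≤n)) = cong +_ (begin
    n / 2 / suc q + 1          ≡⟨ cong (_+ 1) (m/n/o≡m/[n*o] n 2 (suc q)) ⟩
    n / D + 1                  ≡⟨ cong (λ x → n / D + x) (n/n≡1 D) ⟨
    n / D + D / D              ≡⟨ +-distrib-/-∣ʳ n (∣-refl {D}) ⟨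
    (n + D) / D                ≡⟨ cong (_/ D) (+-suc n (D ∸ 1)) ⟩
    (suc n + (D ∸ 1)) / D      ∎)
  where
  open ≡-Reasoning
  D = 2 * suc q

bound≡colours : ∀ n m → bound (suc n) (suc m) ≡ + Construction.colours (suc m) (suc n)
bound≡colours n m = begin
  bound N M
    ≡⟨ cong (λ x → (((x ℤ.- + A) ℤ.- + S) ℤ.- F) ℤ.+ + M) NM≡ ⟩
  ((((+ T ℤ.+ + A ℤ.+ (F ℤ.+ + 1) ℤ.+ + S) ℤ.- + A) ℤ.- + S) ℤ.- F) ℤ.+ + M
    ≡⟨ cancel (+ T) (+ A) F (+ S) (+ M) ⟩
  + 1 ℤ.+ (+ M ℤ.+ + T)
    ≡⟨ cong (λ x → + 1 ℤ.+ x) (ℤP.pos-+ M T) ⟨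
  + 1 ℤ.+ + (M + T)
    ≡⟨ ℤP.pos-+ 1 (M + T) ⟨
  + suc (M + T) ∎
  where
  open ≡-Reasoning
  open Construction (suc m) (suc n)
  N = suc n
  M = suc m
  T = before M
  A = ceilDiv N 2
  U = count (1+multiple period) N
  S = sumTerm N M
  F = ((+ (N / 2)) ℤ.- (+ 1)) ℤ./ℕ suc ((M + 1) / 2)
  U≡F+1 : + U ≡ F ℤ.+ + 1
  U≡F+1 = begin
    + U                       ≡⟨ cong +_ (trans (count-1+multiple period n) (count-multiple (period ∸ 1) n)) ⟩
    + ceilDiv n period        ≡⟨ ⌊[⌊[n+1]/2⌋-1]/[q+1]⌋+1≡⌈n/[2q+2]⌉ ((M + 1) / 2) n ⟨
    F ℤ.+ + 1                 ∎
  NM≡ : + (N * M) ≡ + T ℤ.+ + A ℤ.+ (F ℤ.+ + 1) ℤ.+ + S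
  NM≡ = begin
    + (N * M)                     ≡⟨ cong +_ (count-fresh-all m) ⟨
    + (T + A + U + S)             ≡⟨ ℤP.pos-+ (T + A + U) S ⟩
    + (T + A + U) ℤ.+ + S         ≡⟨ cong (ℤ._+ + S) (ℤP.pos-+ (T + A) U) ⟩
    + (T + A) ℤ.+ + U ℤ.+ + S     ≡⟨ cong (λ x → x ℤ.+ + U ℤ.+ + S) (ℤP.pos-+ T A) ⟩
    + T ℤ.+ + A ℤ.+ + U ℤ.+ + S   ≡⟨ cong (λ x → + T ℤ.+ + A ℤ.+ x ℤ.+ + S) U≡F+1 ⟩
    + T ℤ.+ + A ℤ.+ (F ℤ.+ + 1) ℤ.+ + S ∎
  cancel : ∀ t a f s k →
    ((((t ℤ.+ a ℤ.+ (f ℤ.+ ℤ.1ℤ) ℤ.+ s) ℤ.- a) ℤ.- s) ℤ.- f) ℤ.+ k ≡ ℤ.1ℤ ℤ.+ (k ℤ.+ t)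
  cancel = ℤSolver.solve-∀

corollary2p7 : (n m : ℕ) → n ≥ 1 → m ≥ 1 → PackingChromaticLe (lex (P n) (K m)) (bound n m)
corollary2p7 (suc n) (suc m) _ _ =
  colours , ℤP.≤-reflexive (sym (bound≡colours n m)) , colouring , colouring-packing
  where open Construction (suc m) (suc n)
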